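{- There exist subsets $I_1, I_2, I_3, I_4 \subseteq [4]$, each of size $3$, such that with $\mathcal I = (I_1, I_2, I_3, I_4)$, $R_2 \mid S_2$ is an $\mathcal I$-substructure of $P_3 \mid Q_3$.
   Context: $C_6 = \{(0,0),(0,1),(1,0),(1,2),(2,1),(2,2)\}$, $C_6^*=C_6\setminus\{(0,0)\}$, $S_2 = C_6\times C_6\subseteq\{0,1,2\}^4$, $R_2 = (C_6^*\times C_6)\cup(C_6\times C_6^*)$. $P_3 = \{0101,1111,1220,2222,2012\}\subseteq\{0,1,2\}^4$ and $Q_3 = P_3\cup\{0000\}$. For $I\subseteq[r]$, $\pi_I x=(x_i:i\in I)$. For $P\subsetneq Q\subseteq D_1^{r_1}$, $R\subsetneq S\subseteq D_2^{r_2}$ and $\mathcal I=(I_1,\dots,I_{r_2})$ subsets of $[r_1]$, $P\mid Q$ is an $\mathcal I$-substructure of $R\mid S$ if there exist maps $g_j:D_1^{I_j}\to D_2$ with $(g_1(\pi_{I_1}x),\dots,g_{r_2}(\pi_{I_{r_2}}x))\in R$ for all $x\in P$ and $\in S\setminus R$ for all $x\in Q\setminus P$. -}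

module Defs where

open import Data.Fin using (Fin; zero; suc)
open import Data.Fin.Subset using (Subset; ∣_∣) renaming (_∈_ to _∈ₛ_)
open import Data.Vec using (Vec; []; _∷_; lookup; tabulate)
open import Data.List using (List; []; _∷_)
open import Data.List.Membership.Propositional using (_∈_)
open import Data.Product using (Σ; _×_; _,_)
open import Data.Sum using (_⊎_)
open import Data.Nat using (ℕ)
open import Relation.Nullary using (¬_)
open import Relation.Binary.PropositionalEquality using (_≡_)

D : Set
D = Fin 3

d0 d1 d2 : D
d0 = zero
d1 = suc zero
d2 = suc (suc zero)

C6list : List (D × D)
C6list = (d0 , d0) ∷ (d0 , d1) ∷ (d1 , d0) ∷ (d1 , d2) ∷ (d2 , d1) ∷ (d2 , d2) ∷ []

C6 : D → D → Set
C6 a b = (a , b) ∈ C6list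

C6* : D → D → Set
C6* a b = C6 a b × ¬ ((a , b) ≡ (d0 , d0))

Tuple4 : Set
Tuple4 = Vec D 4

S₂ : Tuple4 → Set
S₂ x = C6 (lookup x zero) (lookup x (suc zero))
     × C6 (lookup x (suc (suc zero))) (lookup x (suc (suc (suc zero))))

R₂ : Tuple4 → Set
R₂ x = (C6* a b × C6 c e) ⊎ (C6 a b × C6* c e)
  where
  a = lookup x zero
  b = lookup x (suc zero)
  c = lookup x (suc (suc zero))
  e = lookup x (suc (suc (suc zero)))

P₃list : List Tuple4
P₃list = (d0 ∷ d1 ∷ d0 ∷ d1 ∷ [])
       ∷ (d1 ∷ d1 ∷ d1 ∷ d1 ∷ [])
       ∷ (d1 ∷ d2 ∷ d2 ∷ d0 ∷ [])
       ∷ (d2 ∷ d2 ∷ d2 ∷ d2 ∷ [])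
       ∷ (d2 ∷ d0 ∷ d1 ∷ d2 ∷ [])
       ∷ []

P₃ : Tuple4 → Set
P₃ x = x ∈ P₃list

Q₃ : Tuple4 → Set
Q₃ x = x ∈ ((d0 ∷ d0 ∷ d0 ∷ d0 ∷ []) ∷ P₃list)

-- D^I for I ⊆ [r]: functions on the elements of I
Restr : (D₁ : Set) {r : ℕ} → Subset r → Set
Restr D₁ {r} I = (i : Fin r) → i ∈ₛ I → D₁

π : {D₁ : Set} {r : ℕ} (I : Subset r) → Vec D₁ r → Restr D₁ I
π I x = λ i _ → lookup x i

IsSubstructure : {D₁ D₂ : Set} {r₁ r₂ : ℕ}
  (P Q : Vec D₁ r₁ → Set) (R S : Vec D₂ r₂ → Set)
  (𝓘 : Vec (Subset r₁) r₂) → Set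
IsSubstructure {D₁} {D₂} {r₁} {r₂} P Q R S 𝓘 =
  Σ ((j : Fin r₂) → Restr D₁ (lookup 𝓘 j) → D₂) λ g →
      ((x : Vec D₁ r₁) → P x → R (tabulate λ j → g j (π (lookup 𝓘 j) x)))
    × ((x : Vec D₁ r₁) → Q x → ¬ P x →
         S (tabulate λ j → g j (π (lookup 𝓘 j) x))
       × ¬ R (tabulate λ j → g j (π (lookup 𝓘 j) x)))

-- With Iⱼ = [4] ∖ {j}, a family (gⱼ) determines a map x ↦ y on S₂ in which yⱼ
-- does not depend on xⱼ.  Exactly one such map sends R₂ into P₃ and 0000 to 0000;
-- writing x ∈ S₂ as a pair of elements of C₆, it is
--
--          00    01    10    12    21    22
--    00   0000  1220  0101  1111  2222  2012
--    01   2012  2222  1111  1111  2222  2012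
--    10   0101  1111  0101  1111  2012  2012
--    12   1111  1111  1111  1111  2012  2012
--    21   2222  2222  1220  1220  2222  2222
--    22   1220  1220  1220  1220  2222  2222
--
-- and gⱼ below, a function of the three coordinates other than j, reads off its
-- j-th coordinate (inputs not of the form π_{Iⱼ} x with x ∈ S₂ are filled
-- arbitrarily).  All relations involved are decidable and the domain is finite,
-- so the substructure conditions are then checked by evaluation.

module Submission where

open import Defs
open import Level using (0ℓ)
open import Data.Nat using (ℕ; zero; suc)
open import Data.Fin using (Fin)
open import Data.Fin.Patterns using (0F; 1F; 2F; 3F)
open import Data.Fin.Properties using (_≟_; all?)
open import Data.Fin.Subset using (Subset; ∣_∣; ⁅_⁆; ∁)
open import Data.Fin.Subset.Properties using () renaming (_∈?_ to _∈ₛ?_)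
open import Data.List using (_∷_)
open import Data.Vec using (Vec; []; _∷_; lookup; tabulate)
open import Data.Vec.Relation.Unary.All using (All; []; _∷_)
open import Data.Product using (Σ; _×_; _,_)
import Data.Product.Properties as Product
import Data.Vec.Properties as Vec
import Data.List.Membership.DecPropositional as DecMembership
open import Relation.Nullary using (Dec; ¬_; ¬?)
open import Relation.Nullary.Decidable
  using (True; toWitness; from-yes; map′; _×-dec_; _⊎-dec_; _→-dec_)
open import Relation.Unary using (Pred; Decidable)
open import Relation.Binary.PropositionalEquality using (_≡_; refl)

all-Vec? : ∀ {n k p} {P : Pred (Vec (Fin n) k) p} → Decidable P → Dec (∀ xs → P xs)
all-Vec? {k = zero}  P? = map′ (λ { p [] → p }) (λ ∀P → ∀P []) (P? [])
all-Vec? {k = suc k} P? =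
  map′ (λ { ∀P (x ∷ xs) → ∀P x xs }) (λ ∀P x xs → ∀P (x ∷ xs))
       (all? λ x → all-Vec? λ xs → P? (x ∷ xs))

Maps : (D₁ D₂ : Set) {r₁ r₂ : ℕ} → Vec (Subset r₁) r₂ → Set
Maps D₁ D₂ {r₂ = r₂} 𝓘 = (j : Fin r₂) → Restr D₁ (lookup 𝓘 j) → D₂

module _ {D₁ D₂ : Set} {r₁ r₂ : ℕ} (𝓘 : Vec (Subset r₁) r₂) where

  induced : Maps D₁ D₂ 𝓘 → Vec D₁ r₁ → Vec D₂ r₂
  induced g x = tabulate λ j → g j (π (lookup 𝓘 j) x)

  IsSubstructureVia : (P Q : Pred (Vec D₁ r₁) 0ℓ) (R S : Pred (Vec D₂ r₂) 0ℓ) →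
                      Maps D₁ D₂ 𝓘 → Set
  IsSubstructureVia P Q R S g =
      (∀ x → P x → R (induced g x))
    × (∀ x → Q x → ¬ P x → S (induced g x) × ¬ R (induced g x))

module _ {n r₁ r₂ : ℕ} {D₂ : Set}
         {P Q : Pred (Vec (Fin n) r₁) 0ℓ} {R S : Pred (Vec D₂ r₂) 0ℓ}
         (P? : Decidable P) (Q? : Decidable Q) (R? : Decidable R) (S? : Decidable S)
         (𝓘 : Vec (Subset r₁) r₂) (g : Maps (Fin n) D₂ 𝓘) where

  isSubstructureVia? : Dec (IsSubstructureVia 𝓘 P Q R S g)
  isSubstructureVia? =
        all-Vec? (λ x → P? x →-dec R? (gx x))
    ×-dec all-Vec? (λ x → Q? x →-dec ¬? (P? x) →-dec S? (gx x) ×-dec ¬? (R? (gx x)))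
    where
    gx : Vec (Fin n) r₁ → Vec D₂ r₂
    gx = induced 𝓘 g

infixl 9 _!_
_!_ : ∀ {A : Set} {r} {I : Subset r} → Restr A I → (i : Fin r) → {True (i ∈ₛ? I)} → A
(f ! i) {i∈I} = f i (toWitness i∈I)

C6? : ∀ a b → Dec (C6 a b)
C6? a b = (a , b) ∈? C6list
  where open DecMembership (Product.≡-dec _≟_ _≟_)

C6*? : ∀ a b → Dec (C6* a b)
C6*? a b = C6? a b ×-dec ¬? (Product.≡-dec _≟_ _≟_ (a , b) (d0 , d0))

S₂? : Decidable S₂
S₂? (a ∷ b ∷ c ∷ e ∷ []) = C6? a b ×-dec C6? c e

R₂? : Decidable R₂
R₂? (a ∷ b ∷ c ∷ e ∷ []) = (C6*? a b ×-dec C6? c e) ⊎-dec (C6? a b ×-dec C6*? c e)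

P₃? : Decidable P₃
P₃? x = x ∈? P₃list
  where open DecMembership (Vec.≡-dec _≟_)

Q₃? : Decidable Q₃
Q₃? x = x ∈? (d0 ∷ d0 ∷ d0 ∷ d0 ∷ []) ∷ P₃list
  where open DecMembership (Vec.≡-dec _≟_)

𝓘 : Vec (Subset 4) 4
𝓘 = tabulate λ j → ∁ ⁅ j ⁆

g₀ g₁ g₂ g₃ : D → D → D → D
g₀ _  2F _  = 2F
g₀ 1F 0F _  = 2F
g₀ 0F _  0F = 0F
g₀ _  _  _  = 1F

g₁ 2F _  _  = 2F
g₁ 1F 2F _  = 0F
g₁ 1F _  _  = 1F
g₁ _  1F _  = 1F
g₁ _  _  1F = 2F
g₁ _  _  _  = 0F

g₂ 2F _  _  = 2F
g₂ 0F _  1F = 2F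
g₂ _  0F 0F = 0F
g₂ _  _  _  = 1F

g₃ _  _  2F = 2F
g₃ 1F _  _  = 1F
g₃ _  1F 0F = 2F
g₃ 2F _  _  = 0F
g₃ _  _  1F = 1F
g₃ _  _  _  = 0F

g : Maps D D 𝓘
g 0F f = g₀ (f ! 1F) (f ! 2F) (f ! 3F)
g 1F f = g₁ (f ! 0F) (f ! 2F) (f ! 3F)
g 2F f = g₂ (f ! 0F) (f ! 1F) (f ! 3F)
g 3F f = g₃ (f ! 0F) (f ! 1F) (f ! 2F)

lemmaC7 : Σ (Vec (Subset 4) 4) λ 𝓘 →
            All (λ I → ∣ I ∣ ≡ 3) 𝓘 × IsSubstructure R₂ S₂ P₃ Q₃ 𝓘
lemmaC7 = 𝓘 , (refl ∷ refl ∷ refl ∷ refl ∷ [])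
            , g , from-yes (isSubstructureVia? R₂? S₂? P₃? Q₃? 𝓘 g)
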